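{- For integers $\alpha\geq 3$, $\beta\geq 9$, and $\rho\geq 4$, define \[k_\alpha=2^{2\alpha}+2^\alpha+2,\qquad K_\beta=2^{2\beta+1}+3\cdot 2^{\beta+3}+49,\qquad \kappa_\rho=2^\rho+2.\] Then \[\Gamma(k_\alpha)\geq 3\cdot 2^{2\alpha}-2^\alpha+1,\qquad \Gamma(K_\beta)\geq 3\cdot 2^{2\beta+1}-2^{\beta-1}+1,\qquad \Gamma(\kappa_\rho)\geq 5\cdot 2^{\rho-1}-8\chi(\rho)+1,\] where $\chi(\rho)=1$ if $\rho$ is even and $\chi(\rho)=2$ if $\rho$ is odd.
   Context: The Thue-Morse word is the infinite binary word ${\bf t}={\bf t}_1{\bf t}_2{\bf t}_3\cdots$, where ${\bf t}_i\in\{0,1\}$ has the same parity as the number of $1$'s in the binary expansion of $i-1$. A $k$-anti-power is a word of the form $w_1w_2\cdots w_k$ where $w_1,\ldots,w_k$ are pairwise distinct words all of the same length. Let $\mathcal F(k)$ denote the set of odd positive integers $m$ such that the prefix of ${\bf t}$ of length $km$ is a $k$-anti-power. Define $\Gamma(k)=\sup\big((2\mathbb Z^+-1)\setminus\mathcal F(k)\big)$, the supremum of the set of odd positive integers not in $\mathcal F(k)$. -}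

module Defs where

open import Data.Nat using (ℕ; zero; suc; _+_; _*_; _∸_; _^_; _≤_; _<_)
open import Data.Nat.DivMod using (_/_; _%_)
open import Data.List using (List; map; upTo)
open import Data.Product using (∃-syntax; _×_)
open import Relation.Binary.PropositionalEquality using (_≡_; _≢_)
open import Relation.Nullary using (¬_)

-- number of 1's in the binary expansion of n, computed with fuel
-- (fuel n suffices since n / 2 < n for n > 0)
popcountAux : ℕ → ℕ → ℕ
popcountAux zero    n = 0
popcountAux (suc f) n = n % 2 + popcountAux f (n / 2)

popcount : ℕ → ℕ
popcount n = popcountAux n n

-- 0-indexed Thue-Morse word: tm n = t_{n+1} = parity of popcount n
tm : ℕ → ℕ
tm n = popcount n % 2

-- the (j+1)-th block of length m of t, i.e. t_{jm+1} ... t_{jm+m}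
block : ℕ → ℕ → List ℕ
block m j = map (λ r → tm (j * m + r)) (upTo m)

AntiPowerPrefix : ℕ → ℕ → Set
AntiPowerPrefix k m = ∀ i j → i < k → j < k → i ≢ j → block m i ≢ block m j

InF : ℕ → ℕ → Set
InF k m = (m % 2 ≡ 1) × AntiPowerPrefix k m

-- Γ(k) ≥ N, where Γ(k) = sup of the odd positive integers not in F(k).
-- For a set of integers, sup S ≥ N iff S contains an element ≥ N.
GammaAtLeast : ℕ → ℕ → Set
GammaAtLeast k N = ∃[ m ] ((m % 2 ≡ 1) × (N ≤ m) × ¬ InF k m)

chi : ℕ → ℕ
chi ρ = 1 + ρ % 2

kα : ℕ → ℕ
kα α = 2 ^ (2 * α) + 2 ^ α + 2

Kβ : ℕ → ℕ
Kβ β = 2 ^ (2 * β + 1) + 3 * 2 ^ (β + 3) + 49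

κρ : ℕ → ℕ
κρ ρ = 2 ^ ρ + 2

module Submission where

-- For u < 2^L the binary expansion of x·2^L + u is that of x followed by that of u, so
-- tm (x·2^L + u) = tm x + tm u mod 2.  If i·m = G·2^L + s then (i + 2^L)·m = (G + m)·2^L + s,
-- hence the blocks i and i + 2^L of length m coincide as soon as tm (G + c) = tm (G + c + m) for
-- the few c with [c·2^L, (c+1)·2^L) meeting [s, s + m).  In each family i and an odd m are chosen
-- so that only c < 3 (resp. 2 ≤ c < 5) occur, and the comparison reduces to tm on a handful of
-- small numbers.

open import Defs
open import Data.Nat
open import Data.Nat.Properties
open import Data.Nat.DivMod
open import Data.Nat.Divisibility using (_∣_; divides; divides-refl; m∣m*n; ∣m⇒∣m*n; ∣n⇒∣m*n)
open import Data.Nat.Tactic.RingSolver using (solve-∀)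
open import Data.Product using (_×_; _,_; ∃-syntax)
open import Function using (id)
open import Relation.Nullary using (¬_)
open import Data.List.Properties using (map-cong-local)
open import Data.List.Relation.Unary.All.Properties using (applyUpTo⁺₁)
open import Relation.Binary.PropositionalEquality
open import Algebra.Properties.CommutativeSemigroup +-commutativeSemigroup using (x∙yz≈y∙xz; interchange)

n≤1+k⇒n/2≤k : ∀ {n k} → n ≤ suc k → n / 2 ≤ k
n≤1+k⇒n/2≤k {zero}  _         = z≤n
n≤1+k⇒n/2≤k {suc n} 1+n≤1+k = ≤-pred (≤-trans (m/n<m (suc n) 2 (s≤s (s≤s z≤n))) 1+n≤1+k)

[m∸n+1]+n≡m+1 : ∀ {m n} → n ≤ m → m ∸ n + 1 + n ≡ m + 1
[m∸n+1]+n≡m+1 {m} {n} n≤m = begin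
  m ∸ n + 1 + n    ≡⟨ +-assoc (m ∸ n) 1 n ⟩
  m ∸ n + (1 + n)  ≡⟨ cong (m ∸ n +_) (+-comm 1 n) ⟩
  m ∸ n + (n + 1)  ≡⟨ +-assoc (m ∸ n) n 1 ⟨
  m ∸ n + n + 1    ≡⟨ cong (_+ 1) (m∸n+n≡m n≤m) ⟩
  m + 1            ∎
  where open ≡-Reasoning

k+[m∸n+1]≤m : ∀ {k m n} → k < n → n ≤ m → k + (m ∸ n + 1) ≤ m
k+[m∸n+1]≤m {k} {m} {n} k<n n≤m = begin
  k + (m ∸ n + 1)    ≡⟨ cong (k +_) (+-comm (m ∸ n) 1) ⟩
  k + suc (m ∸ n)    ≡⟨ +-suc k (m ∸ n) ⟩
  suc k + (m ∸ n)    ≤⟨ +-monoˡ-≤ (m ∸ n) k<n ⟩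
  n + (m ∸ n)        ≡⟨ m+[n∸m]≡n n≤m ⟩
  m                  ∎
  where open ≤-Reasoning

[m∸n+1]%2≡1 : ∀ {m n} → 2 ∣ m → 2 ∣ n → (m ∸ n + 1) % 2 ≡ 1
[m∸n+1]%2≡1 {_} {_} (divides-refl m) (divides-refl n) = begin
  (m * 2 ∸ n * 2 + 1) % 2    ≡⟨ cong (λ d → (d + 1) % 2) (*-distribʳ-∸ 2 m n) ⟨
  ((m ∸ n) * 2 + 1) % 2      ≡⟨ cong (_% 2) (+-comm ((m ∸ n) * 2) 1) ⟩
  (1 + (m ∸ n) * 2) % 2      ≡⟨ [m+kn]%n≡m%n 1 (m ∸ n) 2 ⟩
  1                          ∎
  where open ≡-Reasoning

2∣2^[1+n] : ∀ n → 2 ∣ 2 ^ suc n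
2∣2^[1+n] n = m∣m*n (2 ^ n)

2^[2n]≡2^n*2^n : ∀ n → 2 ^ (2 * n) ≡ 2 ^ n * 2 ^ n
2^[2n]≡2^n*2^n n = trans (cong (2 ^_) (cong (n +_) (+-identityʳ n))) (^-distribˡ-+-* 2 n n)

2^[2[1+n]+1]≡8*2^n*2^n : ∀ n → 2 ^ (2 * suc n + 1) ≡ 8 * (2 ^ n * 2 ^ n)
2^[2[1+n]+1]≡8*2^n*2^n n =
  trans (^-distribˡ-+-* 2 (2 * suc n) 1) (trans (cong (_* 2) (2^[2n]≡2^n*2^n (suc n))) (regroup (2 ^ n)))
  where
  regroup : ∀ h → 2 * h * (2 * h) * 2 ≡ 8 * (h * h)
  regroup = solve-∀

3*2^[1+n+3]≡48*2^n : ∀ n → 3 * 2 ^ (suc n + 3) ≡ 48 * 2 ^ n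
3*2^[1+n+3]≡48*2^n n = trans (cong (λ x → 3 * (2 * x)) (^-distribˡ-+-* 2 n 3)) (regroup (2 ^ n))
  where
  regroup : ∀ h → 3 * (2 * (h * 8)) ≡ 48 * h
  regroup = solve-∀

popcountAux-fuel : ∀ f g n → n ≤ f → n ≤ g → popcountAux f n ≡ popcountAux g n
popcountAux-fuel zero    zero    zero    _ _ = refl
popcountAux-fuel (suc f) zero    zero    _ _ = popcountAux-fuel f zero zero z≤n z≤n
popcountAux-fuel zero    (suc g) zero    _ _ = popcountAux-fuel zero g zero z≤n z≤n
popcountAux-fuel (suc f) (suc g) n n≤1+f n≤1+g =
  cong (n % 2 +_) (popcountAux-fuel f g (n / 2) (n≤1+k⇒n/2≤k n≤1+f) (n≤1+k⇒n/2≤k n≤1+g))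

popcount-step : ∀ n → popcount n ≡ n % 2 + popcount (n / 2)
popcount-step zero    = refl
popcount-step (suc n) =
  cong (suc n % 2 +_) (popcountAux-fuel n (suc n / 2) (suc n / 2) (n≤1+k⇒n/2≤k ≤-refl) ≤-refl)

popcount-bit : ∀ b n → b < 2 → popcount (b + n * 2) ≡ b + popcount n
popcount-bit b n b<2 = begin
  popcount (b + n * 2)                             ≡⟨ popcount-step (b + n * 2) ⟩
  (b + n * 2) % 2 + popcount ((b + n * 2) / 2)    ≡⟨ cong₂ (λ x y → x + popcount y) low high ⟩
  b + popcount n                                   ∎
  where
  open ≡-Reasoning
  low : (b + n * 2) % 2 ≡ b
  low = trans ([m+kn]%n≡m%n b n 2) (m<n⇒m%n≡m b<2)
  high : (b + n * 2) / 2 ≡ n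
  high = trans (+-distrib-/-∣ʳ b (divides-refl n)) (cong₂ _+_ (m<n⇒m/n≡0 b<2) (m*n/n≡m n 2))

popcount-shift : ∀ L x u → u < 2 ^ L → popcount (x * 2 ^ L + u) ≡ popcount x + popcount u
popcount-shift zero    x zero    _ =
  trans (cong popcount (trans (+-identityʳ _) (*-identityʳ x))) (sym (+-identityʳ _))
popcount-shift zero    x (suc u) (s≤s ())
popcount-shift (suc L) x u u<2^1+L = begin
  popcount (x * 2 ^ suc L + u)                     ≡⟨ cong popcount split ⟩
  popcount (b + (x * 2 ^ L + q) * 2)               ≡⟨ popcount-bit b (x * 2 ^ L + q) (m%n<n u 2) ⟩
  b + popcount (x * 2 ^ L + q)                     ≡⟨ cong (b +_) (popcount-shift L x q q<2^L) ⟩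
  b + (popcount x + popcount q)                    ≡⟨ x∙yz≈y∙xz b (popcount x) _ ⟩
  popcount x + (b + popcount q)                    ≡⟨ cong (popcount x +_) (popcount-bit b q (m%n<n u 2)) ⟨
  popcount x + popcount (b + q * 2)                ≡⟨ cong (λ y → popcount x + popcount y) u≡b+q*2 ⟨
  popcount x + popcount u                          ∎
  where
  open ≡-Reasoning
  b = u % 2
  q = u / 2
  u≡b+q*2 : u ≡ b + q * 2
  u≡b+q*2 = m≡m%n+[m/n]*n u 2
  q<2^L : q < 2 ^ L
  q<2^L = m<n*o⇒m/o<n (subst (u <_) (*-comm 2 (2 ^ L)) u<2^1+L)
  split : x * 2 ^ suc L + u ≡ b + (x * 2 ^ L + q) * 2
  split = trans (cong (x * 2 ^ suc L +_) u≡b+q*2) (regroup x (2 ^ L) b q)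
    where
    regroup : ∀ x p b q → x * (2 * p) + (b + q * 2) ≡ b + (x * p + q) * 2
    regroup = solve-∀

popcount-2^n∸1 : ∀ n → popcount (2 ^ n ∸ 1) ≡ n
popcount-2^n∸1 zero    = refl
popcount-2^n∸1 (suc n) = begin
  popcount (2 * 2 ^ n ∸ 1)        ≡⟨ cong popcount 2^[1+n]∸1 ⟩
  popcount (1 + (2 ^ n ∸ 1) * 2)  ≡⟨ popcount-bit 1 (2 ^ n ∸ 1) (s≤s (s≤s z≤n)) ⟩
  suc (popcount (2 ^ n ∸ 1))      ≡⟨ cong suc (popcount-2^n∸1 n) ⟩
  suc n                           ∎
  where
  open ≡-Reasoning
  d = 2 ^ n ∸ 1
  2^[1+n]∸1 : 2 * 2 ^ n ∸ 1 ≡ 1 + d * 2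
  2^[1+n]∸1 = begin
    2 * 2 ^ n ∸ 1        ≡⟨ cong (λ z → 2 * z ∸ 1) (m∸n+n≡m (m^n>0 2 n)) ⟨
    2 * (d + 1) ∸ 1      ≡⟨ cong (_∸ 1) (regroup d) ⟩
    1 + d * 2 + 1 ∸ 1    ≡⟨ m+n∸n≡m (1 + d * 2) 1 ⟩
    1 + d * 2            ∎
    where
    regroup : ∀ d → 2 * (d + 1) ≡ 1 + d * 2 + 1
    regroup = solve-∀

tm-append : ∀ L x u → u < 2 ^ L → tm (x * 2 ^ L + u) ≡ (tm x + tm u) % 2
tm-append L x u u<2^L =
  trans (cong (_% 2) (popcount-shift L x u u<2^L)) (%-distribˡ-+ (popcount x) (popcount u) 2)

tm-append-cong : ∀ L {x y} u → u < 2 ^ L → tm x ≡ tm y → tm (x * 2 ^ L + u) ≡ tm (y * 2 ^ L + u)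
tm-append-cong L {x} {y} u u<2^L tx≡ty = begin
  tm (x * 2 ^ L + u)    ≡⟨ tm-append L x u u<2^L ⟩
  (tm x + tm u) % 2     ≡⟨ cong (λ z → (z + tm u) % 2) tx≡ty ⟩
  (tm y + tm u) % 2     ≡⟨ tm-append L y u u<2^L ⟨
  tm (y * 2 ^ L + u)    ∎
  where open ≡-Reasoning

block-≡ : ∀ m i j → (∀ {r} → r < m → tm (i * m + r) ≡ tm (j * m + r)) → block m i ≡ block m j
block-≡ m i j agree = map-cong-local (applyUpTo⁺₁ id m agree)

block-shift-≡ : ∀ L m i G s a b → i * m ≡ G * 2 ^ L + s → a * 2 ^ L ≤ s → s + m ≤ b * 2 ^ L →
                (∀ c → a ≤ c → c < b → tm (G + c) ≡ tm (G + c + m)) →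
                block m i ≡ block m (i + 2 ^ L)
block-shift-≡ L m i G s a b i*m≡ a*P≤s s+m≤b*P agree = block-≡ m i (i + P) pointwise
  where
  P = 2 ^ L
  instance
    P≢0 : NonZero P
    P≢0 = m^n≢0 2 L
  pointwise : ∀ {r} → r < m → tm (i * m + r) ≡ tm ((i + P) * m + r)
  pointwise {r} r<m = begin
    tm (i * m + r)              ≡⟨ cong tm digits-i ⟩
    tm ((G + c) * P + u)        ≡⟨ tm-append-cong L {G + c} {G + c + m} u (m%n<n (s + r) P) (agree c a≤c c<b) ⟩
    tm ((G + c + m) * P + u)    ≡⟨ cong tm digits-j ⟨
    tm ((i + P) * m + r)        ∎
    where
    open ≡-Reasoning
    c = (s + r) / P
    u = (s + r) % P
    digits-i : i * m + r ≡ (G + c) * P + u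
    digits-i = begin
      i * m + r             ≡⟨ cong (_+ r) i*m≡ ⟩
      G * P + s + r         ≡⟨ +-assoc (G * P) s r ⟩
      G * P + (s + r)       ≡⟨ cong (G * P +_) (m≡m%n+[m/n]*n (s + r) P) ⟩
      G * P + (u + c * P)   ≡⟨ regroup G P u c ⟩
      (G + c) * P + u       ∎
      where
      regroup : ∀ G P u c → G * P + (u + c * P) ≡ (G + c) * P + u
      regroup = solve-∀
    digits-j : (i + P) * m + r ≡ (G + c + m) * P + u
    digits-j = begin
      (i + P) * m + r           ≡⟨ regroup₁ i P m r ⟩
      i * m + r + m * P         ≡⟨ cong (_+ m * P) digits-i ⟩
      (G + c) * P + u + m * P   ≡⟨ regroup₂ G c P u m ⟩
      (G + c + m) * P + u       ∎
      where
      regroup₁ : ∀ i P m r → (i + P) * m + r ≡ i * m + r + m * P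
      regroup₁ = solve-∀
      regroup₂ : ∀ G c P u m → (G + c) * P + u + m * P ≡ (G + c + m) * P + u
      regroup₂ = solve-∀
    a≤c : a ≤ c
    a≤c = subst (_≤ c) (m*n/n≡m a P) (/-monoˡ-≤ P (≤-trans a*P≤s (m≤m+n s r)))
    c<b : c < b
    c<b = m<n*o⇒m/o<n (<-≤-trans (+-monoʳ-< s r<m) s+m≤b*P)

repeated-block⇒GammaAtLeast : ∀ {k} m i L → m % 2 ≡ 1 → i + 2 ^ L < k →
                              block m i ≡ block m (i + 2 ^ L) → GammaAtLeast k m
repeated-block⇒GammaAtLeast m i L odd i+P<k repeat = m , odd , ≤-refl , not-anti-power
  where
  not-anti-power : ¬ InF _ m
  not-anti-power (_ , anti-power) =
    anti-power i (i + 2 ^ L) (<-trans i<i+P i+P<k) i+P<k (<⇒≢ i<i+P) repeat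
    where
    i<i+P : i < i + 2 ^ L
    i<i+P = m<m+n i (m^n>0 2 L)

-- With A = 2^α and G = 3A + 2, the base-A digits of G + c are (3, 2 + c) and those of
-- G + c + m are (3, 2, 3 + c).
kα-windows-agree : ∀ α m → 3 ≤ α → m + 2 ^ α ≡ 3 * (2 ^ α * 2 ^ α) + 1 →
                   ∀ c → c < 3 → tm (3 * 2 ^ α + 2 + c) ≡ tm (3 * 2 ^ α + 2 + c + m)
kα-windows-agree α m 3≤α m+A≡ c c<3 = begin
  tm (G + c)                              ≡⟨ cong tm (+-assoc (3 * A) 2 c) ⟩
  tm (3 * A + (2 + c))                    ≡⟨ tm-append α 3 (2 + c) (small (+-monoʳ-≤ 2 (<⇒≤ c<3))) ⟩
  (tm 3 + tm (2 + c)) % 2                 ≡⟨ table c c<3 ⟩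
  ((tm 3 + tm 2) % 2 + tm (3 + c)) % 2    ≡⟨ cong (λ z → (z + tm (3 + c)) % 2) (tm-append α 3 2 (small (m≤m+n 2 3))) ⟨
  (tm G + tm (3 + c)) % 2                 ≡⟨ tm-append α G (3 + c) (small (+-monoʳ-≤ 3 (≤-pred c<3))) ⟨
  tm (G * A + (3 + c))                    ≡⟨ cong tm G+c+m≡ ⟨
  tm (G + c + m)                          ∎
  where
  open ≡-Reasoning
  A = 2 ^ α
  G = 3 * A + 2
  small : ∀ {d} → d ≤ 5 → d < A
  small d≤5 = ≤-trans (s≤s d≤5) (≤-trans (m≤m+n 6 2) (^-monoʳ-≤ 2 3≤α))
  table : ∀ c → c < 3 → (tm 3 + tm (2 + c)) % 2 ≡ ((tm 3 + tm 2) % 2 + tm (3 + c)) % 2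
  table 0 _ = refl
  table 1 _ = refl
  table 2 _ = refl
  table (suc (suc (suc _))) (s≤s (s≤s (s≤s ())))
  G+c+m≡ : G + c + m ≡ G * A + (3 + c)
  G+c+m≡ = +-cancelʳ-≡ A _ _ (begin
    G + c + m + A              ≡⟨ +-assoc (G + c) m A ⟩
    G + c + (m + A)            ≡⟨ cong (G + c +_) m+A≡ ⟩
    G + c + (3 * (A * A) + 1)  ≡⟨ regroup A c ⟩
    G * A + (3 + c) + A        ∎)
    where
    regroup : ∀ A c → 3 * A + 2 + c + (3 * (A * A) + 1) ≡ (3 * A + 2) * A + (3 + c) + A
    regroup = solve-∀

GammaAtLeast-kα : ∀ α → 3 ≤ α → GammaAtLeast (kα α) (3 * 2 ^ (2 * α) ∸ 2 ^ α + 1)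
GammaAtLeast-kα α@(suc α-1) 3≤α =
  repeated-block⇒GammaAtLeast m i (2 * α) odd i+P<k
    (block-shift-≡ (2 * α) m i G 1 0 3 i*m≡ z≤n 1+m≤3P (λ c _ → kα-windows-agree α m 3≤α m+A≡ c))
  where
  open ≡-Reasoning
  A = 2 ^ α
  P = 2 ^ (2 * α)
  m = 3 * P ∸ A + 1
  i = A + 1
  G = 3 * A + 2
  P≡A*A : P ≡ A * A
  P≡A*A = 2^[2n]≡2^n*2^n α
  8≤A : 8 ≤ A
  8≤A = ^-monoʳ-≤ 2 3≤α
  A≤3P : A ≤ 3 * P
  A≤3P = ≤-trans (m≤m*n A A {{m^n≢0 2 α}}) (≤-trans (m≤n*m (A * A) 3) (≤-reflexive (cong (3 *_) (sym P≡A*A))))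
  m+A≡ : m + A ≡ 3 * (A * A) + 1
  m+A≡ = trans ([m∸n+1]+n≡m+1 A≤3P) (cong (λ p → 3 * p + 1) P≡A*A)
  odd : m % 2 ≡ 1
  odd = [m∸n+1]%2≡1 2∣3P (2∣2^[1+n] α-1)
    where
    2∣3P : 2 ∣ 3 * P
    2∣3P = subst (λ p → 2 ∣ 3 * p) (sym P≡A*A) (∣n⇒∣m*n 3 (∣m⇒∣m*n A (2∣2^[1+n] α-1)))
  i+P<k : i + P < kα α
  i+P<k = ≤-reflexive (regroup A P)
    where
    regroup : ∀ A P → suc (A + 1 + P) ≡ P + A + 2
    regroup = solve-∀
  i*m≡ : i * m ≡ G * P + 1
  i*m≡ = +-cancelʳ-≡ (i * A) _ _ (begin
    i * m + i * A                ≡⟨ *-distribˡ-+ i m A ⟨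
    i * (m + A)                  ≡⟨ cong (i *_) m+A≡ ⟩
    i * (3 * (A * A) + 1)        ≡⟨ regroup A ⟩
    G * (A * A) + 1 + i * A      ≡⟨ cong (λ p → G * p + 1 + i * A) P≡A*A ⟨
    G * P + 1 + i * A            ∎)
    where
    regroup : ∀ A → (A + 1) * (3 * (A * A) + 1) ≡ (3 * A + 2) * (A * A) + 1 + (A + 1) * A
    regroup = solve-∀
  1+m≤3P : 1 + m ≤ 3 * P
  1+m≤3P = k+[m∸n+1]≤m (≤-trans (s≤s (s≤s z≤n)) 8≤A) A≤3P

-- With h = 2^L and G = 48h + 46, the base-h digits of G + c are (48, 46 + c) and those of
-- G + c + m are (24, 47, 47 + c).
Kβ-windows-agree : ∀ L m → 6 ≤ L → m + 2 ^ L ≡ 24 * (2 ^ L * 2 ^ L) + 1 →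
                   ∀ c → c < 3 → tm (48 * 2 ^ L + 46 + c) ≡ tm (48 * 2 ^ L + 46 + c + m)
Kβ-windows-agree L m 6≤L m+h≡ c c<3 = begin
  tm (G + c)                                ≡⟨ cong tm (+-assoc (48 * h) 46 c) ⟩
  tm (48 * h + (46 + c))                    ≡⟨ tm-append L 48 (46 + c) (small (+-monoʳ-≤ 46 (<⇒≤ c<3))) ⟩
  (tm 48 + tm (46 + c)) % 2                 ≡⟨ table c c<3 ⟩
  ((tm 24 + tm 47) % 2 + tm (47 + c)) % 2   ≡⟨ cong (λ z → (z + tm (47 + c)) % 2) (tm-append L 24 47 (small (m≤m+n 47 2))) ⟨
  (tm (24 * h + 47) + tm (47 + c)) % 2      ≡⟨ tm-append L (24 * h + 47) (47 + c) (small (+-monoʳ-≤ 47 (≤-pred c<3))) ⟨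
  tm ((24 * h + 47) * h + (47 + c))         ≡⟨ cong tm G+c+m≡ ⟨
  tm (G + c + m)                            ∎
  where
  open ≡-Reasoning
  h = 2 ^ L
  G = 48 * h + 46
  small : ∀ {d} → d ≤ 49 → d < h
  small d≤49 = ≤-trans (s≤s d≤49) (≤-trans (m≤m+n 50 14) (^-monoʳ-≤ 2 6≤L))
  table : ∀ c → c < 3 → (tm 48 + tm (46 + c)) % 2 ≡ ((tm 24 + tm 47) % 2 + tm (47 + c)) % 2
  table 0 _ = refl
  table 1 _ = refl
  table 2 _ = refl
  table (suc (suc (suc _))) (s≤s (s≤s (s≤s ())))
  G+c+m≡ : G + c + m ≡ (24 * h + 47) * h + (47 + c)
  G+c+m≡ = +-cancelʳ-≡ h _ _ (begin
    G + c + m + h                 ≡⟨ +-assoc (G + c) m h ⟩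
    G + c + (m + h)               ≡⟨ cong (G + c +_) m+h≡ ⟩
    G + c + (24 * (h * h) + 1)    ≡⟨ regroup h c ⟩
    (24 * h + 47) * h + (47 + c) + h ∎)
    where
    regroup : ∀ h c → 48 * h + 46 + c + (24 * (h * h) + 1) ≡ (24 * h + 47) * h + (47 + c) + h
    regroup = solve-∀

GammaAtLeast-Kβ : ∀ β → 9 ≤ β → GammaAtLeast (Kβ β) (3 * 2 ^ (2 * β + 1) ∸ 2 ^ (β ∸ 1) + 1)
GammaAtLeast-Kβ 1 (s≤s ())
GammaAtLeast-Kβ β@(suc L@(suc L-1)) 9≤β =
  repeated-block⇒GammaAtLeast m i (2 * β + 1) odd i+P<k
    (block-shift-≡ (2 * β + 1) m i G 16 0 3 i*m≡ z≤n 16+m≤3P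
      (λ c _ → Kβ-windows-agree L m (≤-trans (m≤m+n 6 2) (≤-pred 9≤β)) m+h≡ c))
  where
  open ≡-Reasoning
  h = 2 ^ L
  P = 2 ^ (2 * β + 1)
  m = 3 * P ∸ h + 1
  i = 16 * h + 16
  G = 48 * h + 46
  P≡8hh : P ≡ 8 * (h * h)
  P≡8hh = 2^[2[1+n]+1]≡8*2^n*2^n L
  h≤3P : h ≤ 3 * P
  h≤3P = ≤-trans (m≤m*n h h {{m^n≢0 2 L}})
           (≤-trans (m≤n*m (h * h) 24) (≤-reflexive (trans (*-assoc 3 8 (h * h)) (cong (3 *_) (sym P≡8hh)))))
  m+h≡ : m + h ≡ 24 * (h * h) + 1
  m+h≡ = trans ([m∸n+1]+n≡m+1 h≤3P) (cong (_+ 1) (trans (cong (3 *_) P≡8hh) (sym (*-assoc 3 8 (h * h)))))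
  odd : m % 2 ≡ 1
  odd = [m∸n+1]%2≡1 2∣3P (2∣2^[1+n] L-1)
    where
    2∣3P : 2 ∣ 3 * P
    2∣3P = ∣n⇒∣m*n 3 (subst (2 ∣_) (sym P≡8hh) (∣m⇒∣m*n (h * h) (divides 4 refl)))
  i+P<k : i + P < Kβ β
  i+P<k = subst (i + P <_) (cong (λ x → P + x + 49) (sym (3*2^[1+n+3]≡48*2^n L)))
            (≤-trans (m≤m+n (suc (i + P)) (32 * h + 32)) (≤-reflexive (regroup h P)))
    where
    regroup : ∀ h P → suc (16 * h + 16 + P) + (32 * h + 32) ≡ P + 48 * h + 49
    regroup = solve-∀
  i*m≡ : i * m ≡ G * P + 16
  i*m≡ = +-cancelʳ-≡ (i * h) _ _ (begin
    i * m + i * h                  ≡⟨ *-distribˡ-+ i m h ⟨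
    i * (m + h)                    ≡⟨ cong (i *_) m+h≡ ⟩
    i * (24 * (h * h) + 1)         ≡⟨ regroup h ⟩
    G * (8 * (h * h)) + 16 + i * h ≡⟨ cong (λ p → G * p + 16 + i * h) P≡8hh ⟨
    G * P + 16 + i * h             ∎)
    where
    regroup : ∀ h → (16 * h + 16) * (24 * (h * h) + 1) ≡ (48 * h + 46) * (8 * (h * h)) + 16 + (16 * h + 16) * h
    regroup = solve-∀
  16+m≤3P : 16 + m ≤ 3 * P
  16+m≤3P = k+[m∸n+1]≤m (≤-trans (m≤m+n 17 239) (^-monoʳ-≤ 2 (≤-pred 9≤β))) h≤3P

-- With E = 2^e and S = 2^(2t), c + m = (4S + (S ∸ 1))·E + (1 + c), and 4S + (S ∸ 1) has 2t + 1
-- ones in binary, so tm (c + m) is the complement of tm (1 + c).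
κ-windows-agree : ∀ e t m → 3 ≤ e → m + 2 ^ e ≡ 5 * 2 ^ (e + t * 2) + 1 →
                  ∀ c → 2 ≤ c → c < 5 → tm c ≡ tm (c + m)
κ-windows-agree e t m 3≤e m+E≡ c 2≤c c<5 = begin
  tm c                          ≡⟨ table c 2≤c c<5 ⟩
  (1 + tm (1 + c)) % 2          ≡⟨ cong (λ z → (z + tm (1 + c)) % 2) tm-X≡1 ⟨
  (tm X + tm (1 + c)) % 2       ≡⟨ tm-append e X (1 + c) 1+c<E ⟨
  tm (X * E + (1 + c))          ≡⟨ cong tm c+m≡ ⟨
  tm (c + m)                    ∎
  where
  open ≡-Reasoning
  E = 2 ^ e
  S = 2 ^ (t * 2)
  D = S ∸ 1
  X = 4 * S + D
  S≡D+1 : S ≡ D + 1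
  S≡D+1 = sym (m∸n+n≡m (m^n>0 2 (t * 2)))
  tm-X≡1 : tm X ≡ 1
  tm-X≡1 = begin
    popcount X % 2            ≡⟨ cong (_% 2) (popcount-shift (t * 2) 4 D (∸-monoʳ-< z<s (m^n>0 2 (t * 2)))) ⟩
    (1 + popcount D) % 2      ≡⟨ cong (λ z → (1 + z) % 2) (popcount-2^n∸1 (t * 2)) ⟩
    (1 + t * 2) % 2           ≡⟨ [m+kn]%n≡m%n 1 t 2 ⟩
    1                         ∎
  1+c<E : 1 + c < E
  1+c<E = ≤-trans (s≤s c<5) (≤-trans (m≤m+n 6 2) (^-monoʳ-≤ 2 3≤e))
  table : ∀ c → 2 ≤ c → c < 5 → tm c ≡ (1 + tm (1 + c)) % 2
  table 2 _ _ = refl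
  table 3 _ _ = refl
  table 4 _ _ = refl
  table 1 (s≤s ()) _
  table (suc (suc (suc (suc (suc _))))) _ (s≤s (s≤s (s≤s (s≤s (s≤s ())))))
  c+m≡ : c + m ≡ X * E + (1 + c)
  c+m≡ = +-cancelʳ-≡ E _ _ (begin
    c + m + E                              ≡⟨ +-assoc c m E ⟩
    c + (m + E)                            ≡⟨ cong (c +_) m+E≡ ⟩
    c + (5 * 2 ^ (e + t * 2) + 1)          ≡⟨ cong (λ h → c + (5 * h + 1)) (^-distribˡ-+-* 2 e (t * 2)) ⟩
    c + (5 * (E * S) + 1)                  ≡⟨ cong (λ s → c + (5 * (E * s) + 1)) S≡D+1 ⟩
    c + (5 * (E * (D + 1)) + 1)            ≡⟨ regroup c E D ⟩
    (4 * (D + 1) + D) * E + (1 + c) + E    ≡⟨ cong (λ s → (4 * s + D) * E + (1 + c) + E) S≡D+1 ⟨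
    X * E + (1 + c) + E                    ∎)
    where
    regroup : ∀ c E D → c + (5 * (E * (D + 1)) + 1) ≡ (4 * (D + 1) + D) * E + (1 + c) + E
    regroup = solve-∀

GammaAtLeast-κ : ∀ e t → 3 ≤ e → GammaAtLeast (2 ^ suc (e + t * 2) + 2) (5 * 2 ^ (e + t * 2) ∸ 2 ^ e + 1)
GammaAtLeast-κ e@(suc e-1) t 3≤e =
  repeated-block⇒GammaAtLeast m 1 (suc n) odd (≤-reflexive (+-comm 2 (2 * H)))
    (block-shift-≡ (suc n) m 1 0 m 2 5 (*-identityˡ m) 4H≤m m+m≤10H (κ-windows-agree e t m 3≤e m+E≡))
  where
  n = e + t * 2
  H = 2 ^ n
  E = 2 ^ e
  m = 5 * H ∸ E + 1
  E≤H : E ≤ H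
  E≤H = subst (E ≤_) (sym (^-distribˡ-+-* 2 e (t * 2))) (m≤m*n E (2 ^ (t * 2)) {{m^n≢0 2 (t * 2)}})
  m+E≡ : m + E ≡ 5 * H + 1
  m+E≡ = [m∸n+1]+n≡m+1 (≤-trans E≤H (m≤n*m H 5))
  odd : m % 2 ≡ 1
  odd = [m∸n+1]%2≡1 (∣n⇒∣m*n 5 (2∣2^[1+n] (e-1 + t * 2))) (2∣2^[1+n] e-1)
  4H≤m : 2 * (2 * H) ≤ m
  4H≤m = +-cancelʳ-≤ E (2 * (2 * H)) m (begin
    2 * (2 * H) + E    ≤⟨ +-monoʳ-≤ (2 * (2 * H)) E≤H ⟩
    2 * (2 * H) + H    ≡⟨ regroup H ⟩
    5 * H + 0          ≤⟨ +-monoʳ-≤ (5 * H) z≤n ⟩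
    5 * H + 1          ≡⟨ m+E≡ ⟨
    m + E              ∎)
    where
    open ≤-Reasoning
    regroup : ∀ H → 2 * (2 * H) + H ≡ 5 * H + 0
    regroup = solve-∀
  m+m≤10H : m + m ≤ 5 * (2 * H)
  m+m≤10H = +-cancelʳ-≤ (E + E) (m + m) (5 * (2 * H)) (begin
    m + m + (E + E)        ≡⟨ interchange m m E E ⟩
    (m + E) + (m + E)      ≡⟨ cong₂ _+_ m+E≡ m+E≡ ⟩
    (5 * H + 1) + (5 * H + 1) ≡⟨ regroup H ⟩
    5 * (2 * H) + (1 + 1)  ≤⟨ +-monoʳ-≤ (5 * (2 * H)) (+-mono-≤ 1≤E 1≤E) ⟩
    5 * (2 * H) + (E + E)  ∎)
    where
    open ≤-Reasoning
    1≤E : 1 ≤ E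
    1≤E = m^n>0 2 e
    regroup : ∀ H → (5 * H + 1) + (5 * H + 1) ≡ 5 * (2 * H) + (1 + 1)
    regroup = solve-∀

chi-decomposition : ∀ ρ → 4 ≤ ρ → ∃[ e ] ∃[ t ] (3 ≤ e × ρ ≡ suc (e + t * 2) × 2 ^ e ≡ 8 * chi ρ)
chi-decomposition 1 (s≤s ())
chi-decomposition 2 (s≤s (s≤s ()))
chi-decomposition 3 (s≤s (s≤s (s≤s ())))
chi-decomposition 4 _ = 3 , 0 , ≤-refl , refl , refl
chi-decomposition 5 _ = 4 , 0 , n≤1+n 3 , refl , refl
chi-decomposition (suc (suc ρ@(suc (suc (suc (suc _)))))) _
  with e , t , 3≤e , ρ≡ , 2^e≡ ← chi-decomposition ρ (s≤s (s≤s (s≤s (s≤s z≤n))))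
  = e , suc t , 3≤e , trans (cong (2 +_) ρ≡) (regroup e t) , 2^e≡
  where
  regroup : ∀ e t → 2 + suc (e + t * 2) ≡ suc (e + suc t * 2)
  regroup = solve-∀

GammaAtLeast-κρ : ∀ ρ → 4 ≤ ρ → GammaAtLeast (κρ ρ) (5 * 2 ^ (ρ ∸ 1) ∸ 8 * chi ρ + 1)
GammaAtLeast-κρ ρ 4≤ρ with e , t , 3≤e , refl , 2^e≡8χ ← chi-decomposition ρ 4≤ρ =
  subst (λ E → GammaAtLeast (κρ ρ) (5 * 2 ^ (ρ ∸ 1) ∸ E + 1)) 2^e≡8χ (GammaAtLeast-κ e t 3≤e)

lemma2 : ((α : ℕ) → 3 ≤ α → GammaAtLeast (kα α) (3 * 2 ^ (2 * α) ∸ 2 ^ α + 1))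
       × ((β : ℕ) → 9 ≤ β → GammaAtLeast (Kβ β) (3 * 2 ^ (2 * β + 1) ∸ 2 ^ (β ∸ 1) + 1))
       × ((ρ : ℕ) → 4 ≤ ρ → GammaAtLeast (κρ ρ) (5 * 2 ^ (ρ ∸ 1) ∸ 8 * chi ρ + 1))
lemma2 = GammaAtLeast-kα , GammaAtLeast-Kβ , GammaAtLeast-κρ
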